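{- Let $0\le h''\le k'\le n$ be integers with $2\mid h''$. Assume $S'\subseteq[1,n]^2$ is a no-$(k'+1)$-in-line set of size $k'n$ having reserve $h''$. Then there exists a no-$(k'+1)$-in-line set $S''\subseteq[1,n']^2$ of size $k'n'$, where $n'=n+\frac{h''}{2}$.
   Context: $[a,b]=\{x\in\mathbb{Z}:a\le x\le b\}$. A set $S\subseteq\mathcal{G}=[1,m]^2$ is a no-$(k+1)$-in-line set if $|S\cap\ell|\le k$ for every Euclidean line $\ell$; it has reserve $h$ if moreover $|S\cap\ell|\le k-h$ for every line $\ell$ that is neither horizontal nor vertical and meets $\mathcal{G}$ in at least two points. -}

module Defs where

open import Data.Nat using (ℕ; _≤_; _∸_)
open import Data.Integer using (ℤ; +_; _+_; _*_; _≟_)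
open import Data.Product using (_×_; _,_; Σ; ∃)
open import Data.List using (List; length; filter)
open import Data.List.Relation.Unary.All using (All)
open import Data.List.Relation.Unary.Unique.Propositional using (Unique)
open import Relation.Binary.PropositionalEquality using (_≡_; _≢_)
open import Relation.Nullary using (¬_)
open import Relation.Unary using (Decidable)

Point : Set
Point = ℕ × ℕ

InGrid : ℕ → Point → Set
InGrid m (x , y) = (1 ≤ x × x ≤ m) × (1 ≤ y × y ≤ m)

-- Every Euclidean line through two lattice points has such an equation,
-- and every lattice point lies on such a (horizontal) line, so quantifying
-- over these lines suffices for the no-(k+1)-in-line condition.
record Line : Set where
  constructor line
  field
    a b c : ℤ
    nondeg : ¬ (a ≡ + 0 × b ≡ + 0)
open Line public

OnLine : Line → Point → Set
OnLine L (x , y) = a L * + x + b L * + y ≡ c L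

onLine? : (L : Line) → Decidable (OnLine L)
onLine? L (x , y) = (a L * + x + b L * + y) ≟ c L

count : Line → List Point → ℕ
count L S = length (filter (onLine? L) S)

NoInLine : ℕ → ℕ → List Point → Set
NoInLine k m S = Unique S × All (InGrid m) S × (∀ (L : Line) → count L S ≤ k)

MeetsGridTwice : ℕ → Line → Set
MeetsGridTwice m L = Σ Point λ p → Σ Point λ q →
  p ≢ q × InGrid m p × InGrid m q × OnLine L p × OnLine L q

HasReserve : ℕ → ℕ → ℕ → List Point → Set
HasReserve h k m S = ∀ (L : Line) → a L ≢ + 0 → b L ≢ + 0 →
  MeetsGridTwice m L → count L S ≤ k ∸ h

{-# OPTIONS --safe #-}
module Submission where

-- Write h = 2t.  Averaging over the N anti-diagonal bands {(x , y) : (x + y + c) mod N < t}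
-- gives a band containing k·t points of S; let R be k·t of them.  A band meets every row and
-- every column in at most t points.  Remove R from S and put it back twice outside [1,N]²:
-- in the t new rows on top, each point keeping its column, and in the t new columns on the
-- right, each point keeping its row.  Inside a strip the points of R, listed column by column,
-- are dealt out cyclically over the t new rows, so no column receives two points in one row
-- and no new row receives more than k points.  A vertical or horizontal line through the old
-- grid then meets exactly as many points as before and a new row or column at most k, while
-- any other line meets each strip in at most t points and S in at most k − 2t points (the
-- reserve) or in at most one point, and 1 + 2t ≤ k.  The case h = k cannot occur: full reserve
-- forces any two points of S to share a row or a column, so S would lie on a single line.

open import Defs
open import Data.Empty using (⊥; ⊥-elim)
import Data.Integer as ℤ
open import Data.List using (List; []; _∷_; _++_; length; filter; map; take; concatMap; upTo)
open import Data.List.Properties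
  using (length-++; length-map; length-take; length-upTo; length-removeAt′; map-∘; map-id;
         filter-++; filter-≐; filter-all; filter-none; filter-accept; filter-reject)
open import Data.List.Membership.Propositional using (_∈_; _─_; find)
open import Data.List.Membership.Propositional.Properties
  using (∈-filter⁺; ∈-filter⁻; ∈-map⁻; ∈-++⁺ˡ; ∈-++⁺ʳ; ∈-++⁻; ∈-upTo⁺)
open import Data.List.Membership.Propositional.Properties.WithK using (unique∧set⇒bag)
open import Data.List.Relation.Binary.BagAndSetEquality using (∼bag⇒↭)
open import Data.List.Relation.Binary.Permutation.Propositional using (_↭_)
import Data.List.Relation.Binary.Permutation.Propositional.Properties as ↭
open import Data.List.Relation.Unary.All as All using (All; []; _∷_)
import Data.List.Relation.Unary.All.Properties as All
open import Data.List.Relation.Unary.AllPairs using ([]; _∷_)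
open import Data.List.Relation.Unary.Any using (here; there; index; any?)
open import Data.List.Relation.Unary.Unique.Propositional using (Unique)
import Data.List.Relation.Unary.Unique.Propositional.Properties as Unique
open import Data.Nat
  using (ℕ; zero; suc; _+_; _*_; _∸_; _≤_; _<_; _⊓_; _%_; _/_; z≤n; s≤s; z<s;
         NonZero; >-nonZero; >-nonZero⁻¹; _≟_; _<?_; _≤?_)
open import Data.Nat.DivMod
  using (m≡m%n+[m/n]*n; /-monoˡ-≤; m<n⇒m%n≡m; n%n≡0; %-distribˡ-+; m%n%n≡m%n; m%n<n;
         m<n*o⇒m/o<n; m*n/n≡m)
open import Data.Nat.Divisibility using (_∣_; divides)
open import Data.Nat.Properties
  using (≤-refl; ≤-reflexive; ≤-trans; ≤-antisym; ≤-total; <-irrefl; <-trans; <-≤-trans; ≤-<-trans;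
         <⇒≤; <⇒≱; ≮⇒≥; ≰⇒>; ≤∧≢⇒<; ≤-pred; m≤m+n; m<m+n; m≤n⇒m≤1+n; m<n⇒m<1+n; n≤1+n;
         m≤m*n; m<m*n; +-comm; +-assoc; +-suc; +-identityʳ; +-mono-≤; +-monoˡ-≤; +-monoʳ-≤;
         +-monoʳ-<; +-cancelˡ-≡; *-comm; *-assoc; *-suc; *-identityʳ; *-monoˡ-≤; *-distribˡ-+;
         suc-injective; m∸n+n≡m; m+n∸m≡n; n∸n≡0; ∸-monoˡ-<; ∸-cancelʳ-≡; m≤n⇒m⊓n≡m; m≥n⇒m⊓n≡n;
         anyUpTo?; +-commutativeSemigroup; module ≤-Reasoning)
open import Algebra.Properties.CommutativeSemigroup +-commutativeSemigroup
  using (xy∙z≈xz∙y; xy∙z≈yz∙x) renaming (interchange to +-interchange)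
open import Data.Nat.Tactic.RingSolver using (solve-∀)
open import Data.Product using (_×_; _,_; proj₁; proj₂; Σ; ∃; ∃₂; swap)
open import Data.Product.Properties using (≡-dec)
open import Data.Sum as Sum using (_⊎_; inj₁; inj₂)
open import Function using (_∘_; _⇔_; mk⇔; Equivalence)
open import Relation.Binary.PropositionalEquality
  using (_≡_; _≢_; refl; sym; trans; cong; cong₂; subst; subst₂; module ≡-Reasoning)
open import Relation.Nullary using (¬_; Dec; yes; no; ¬?)
open import Relation.Unary using (Decidable)

open import Data.List.Membership.DecPropositional (≡-dec _≟_ _≟_) using (_∈?_)

private
  variable
    A B : Set

-- Counting in lists

countBy : {P : A → Set} → Decidable P → List A → ℕ
countBy P? xs = length (filter P? xs)

module _ {P : A → Set} (P? : Decidable P) where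

  countBy-++ : ∀ xs ys → countBy P? (xs ++ ys) ≡ countBy P? xs + countBy P? ys
  countBy-++ xs ys = trans (cong length (filter-++ P? xs ys)) (length-++ (filter P? xs))

  countBy-↭ : ∀ {xs ys} → xs ↭ ys → countBy P? xs ≡ countBy P? ys
  countBy-↭ xs↭ys = ↭.↭-length (↭.filter-↭ P? xs↭ys)

  countBy-all : ∀ {xs} → All P xs → countBy P? xs ≡ length xs
  countBy-all Pxs = cong length (filter-all P? Pxs)

  countBy-none : ∀ {xs} → All (¬_ ∘ P) xs → countBy P? xs ≡ 0
  countBy-none ¬Pxs = cong length (filter-none P? ¬Pxs)

  countBy-map : ∀ (f : B → A) xs → countBy P? (map f xs) ≡ countBy (P? ∘ f) xs
  countBy-map f [] = refl
  countBy-map f (x ∷ xs) with P? (f x)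
  ... | yes _ = cong suc (countBy-map f xs)
  ... | no _  = countBy-map f xs

module _ {P Q : A → Set} (P? : Decidable P) (Q? : Decidable Q) where

  countBy-mono : (∀ {x} → P x → Q x) → ∀ xs → countBy P? xs ≤ countBy Q? xs
  countBy-mono P⇒Q [] = z≤n
  countBy-mono P⇒Q (x ∷ xs) with P? x | Q? x
  ... | yes _  | yes _  = s≤s (countBy-mono P⇒Q xs)
  ... | yes Px | no ¬Qx = ⊥-elim (¬Qx (P⇒Q Px))
  ... | no _   | yes _  = m≤n⇒m≤1+n (countBy-mono P⇒Q xs)
  ... | no _   | no _   = countBy-mono P⇒Q xs

  countBy-cong : (∀ {x} → P x ⇔ Q x) → ∀ xs → countBy P? xs ≡ countBy Q? xs
  countBy-cong P⇔Q xs = cong length (filter-≐ P? Q? (Equivalence.to P⇔Q , Equivalence.from P⇔Q) xs)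

unique∧set⇒↭ : ∀ {xs ys : List A} → Unique xs → Unique ys → (∀ {z} → z ∈ xs ⇔ z ∈ ys) → xs ↭ ys
unique∧set⇒↭ uxs uys xs≈ys = ∼bag⇒↭ (unique∧set⇒bag uxs uys xs≈ys)

private
  ∈-─ : ∀ {x z} {ys : List A} (x∈ys : x ∈ ys) → z ∈ ys → z ≢ x → z ∈ ys ─ x∈ys
  ∈-─ (here refl)  (here refl)  z≢x = ⊥-elim (z≢x refl)
  ∈-─ (here refl)  (there z∈ys) _   = z∈ys
  ∈-─ (there _)    (here refl)  _   = here refl
  ∈-─ (there x∈ys) (there z∈ys) z≢x = there (∈-─ x∈ys z∈ys z≢x)

Unique-⊆⇒length≤ : ∀ {xs ys : List A} → Unique xs → (∀ {z} → z ∈ xs → z ∈ ys) →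
                   length xs ≤ length ys
Unique-⊆⇒length≤ [] _ = z≤n
Unique-⊆⇒length≤ {xs = x ∷ xs} {ys} (x∉xs ∷ uxs) xs⊆ys = begin
  suc (length xs)           ≤⟨ s≤s (Unique-⊆⇒length≤ uxs xs⊆ys─x) ⟩
  suc (length (ys ─ x∈ys))  ≡⟨ length-removeAt′ ys (index x∈ys) ⟨
  length ys                 ∎
  where
  open ≤-Reasoning
  x∈ys : x ∈ ys
  x∈ys = xs⊆ys (here refl)
  xs⊆ys─x : ∀ {z} → z ∈ xs → z ∈ ys ─ x∈ys
  xs⊆ys─x z∈xs = ∈-─ x∈ys (xs⊆ys (there z∈xs)) (λ z≡x → All.lookup x∉xs z∈xs (sym z≡x))

module _ (f : A → ℕ) where

  private
    map⁺-injectiveOn : ∀ {xs} → Unique xs → (∀ {x y} → x ∈ xs → y ∈ xs → f x ≡ f y → x ≡ y) →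
                       Unique (map f xs)
    map⁺-injectiveOn [] _ = []
    map⁺-injectiveOn (x∉xs ∷ uxs) inj =
      All.map⁺ (All.tabulate (λ y∈xs fx≡fy → All.lookup x∉xs y∈xs (inj (here refl) (there y∈xs) fx≡fy)))
      ∷ map⁺-injectiveOn uxs (λ x∈ y∈ → inj (there x∈) (there y∈))

  length≤-by-injection : ∀ m {xs} → Unique xs → (∀ {x} → x ∈ xs → f x < m) →
                         (∀ {x y} → x ∈ xs → y ∈ xs → f x ≡ f y → x ≡ y) → length xs ≤ m
  length≤-by-injection m {xs} uxs f<m inj = begin
    length xs          ≡⟨ length-map f xs ⟨
    length (map f xs)  ≤⟨ Unique-⊆⇒length≤ (map⁺-injectiveOn uxs inj) f[xs]⊆upTo ⟩
    length (upTo m)    ≡⟨ length-upTo m ⟩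
    m                  ∎
    where
    open ≤-Reasoning
    f[xs]⊆upTo : ∀ {n} → n ∈ map f xs → n ∈ upTo m
    f[xs]⊆upTo n∈ with _ , x∈xs , refl ← ∈-map⁻ f n∈ = ∈-upTo⁺ (f<m x∈xs)

2≤length⇒pair : ∀ {xs : List A} → Unique xs → 2 ≤ length xs → ∃₂ λ x y → x ≢ y × x ∈ xs × y ∈ xs
2≤length⇒pair {xs = _ ∷ []}    _              (s≤s ())
2≤length⇒pair {xs = x ∷ y ∷ _} ((x∉ ∷ _) ∷ _) _ = x , y , x∉ , here refl , there (here refl)

module _ {P : A → Set} (P? : Decidable P) where

  pair⇒2≤countBy : ∀ {x y xs} → x ≢ y → x ∈ xs → y ∈ xs → P x → P y → 2 ≤ countBy P? xs
  pair⇒2≤countBy {x} {y} {xs} x≢y x∈xs y∈xs Px Py = Unique-⊆⇒length≤ ((x≢y ∷ []) ∷ [] ∷ []) pair⊆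
    where
    pair⊆ : ∀ {z} → z ∈ x ∷ y ∷ [] → z ∈ filter P? xs
    pair⊆ (here refl)         = ∈-filter⁺ P? x∈xs Px
    pair⊆ (there (here refl)) = ∈-filter⁺ P? y∈xs Py

  2≤countBy⇒pair : ∀ {xs} → Unique xs → 2 ≤ countBy P? xs →
                   ∃₂ λ x y → x ≢ y × x ∈ xs × y ∈ xs × P x × P y
  2≤countBy⇒pair {xs} uxs 2≤count
    with x , y , x≢y , x∈ , y∈ ← 2≤length⇒pair (Unique.filter⁺ P? uxs) 2≤count
    with x∈xs , Px ← ∈-filter⁻ P? {xs = xs} x∈ | y∈xs , Py ← ∈-filter⁻ P? {xs = xs} y∈
    = x , y , x≢y , x∈xs , y∈xs , Px , Py

-- Residues and sums

%-/-injective : ∀ {N a b} .{{_ : NonZero N}} → a % N ≡ b % N → a / N ≡ b / N → a ≡ b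
%-/-injective {N} {a} {b} a%N≡b%N a/N≡b/N = begin
  a                  ≡⟨ m≡m%n+[m/n]*n a N ⟩
  a % N + a / N * N  ≡⟨ cong₂ (λ r q → r + q * N) a%N≡b%N a/N≡b/N ⟩
  b % N + b / N * N  ≡⟨ m≡m%n+[m/n]*n b N ⟨
  b                  ∎
  where open ≡-Reasoning

private
  %-gap : ∀ {N a b} .{{_ : NonZero N}} → a % N ≡ b % N → a / N < b / N → a + N ≤ b
  %-gap {N} {a} {b} a%N≡b%N a/N<b/N = begin
    a + N                    ≡⟨ cong (_+ N) (m≡m%n+[m/n]*n a N) ⟩
    a % N + a / N * N + N    ≡⟨ +-assoc (a % N) _ N ⟩
    a % N + (a / N * N + N)  ≡⟨ cong₂ _+_ a%N≡b%N (+-comm _ N) ⟩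
    b % N + suc (a / N) * N  ≤⟨ +-monoʳ-≤ (b % N) (*-monoˡ-≤ N a/N<b/N) ⟩
    b % N + b / N * N        ≡⟨ m≡m%n+[m/n]*n b N ⟨
    b                        ∎
    where open ≤-Reasoning

  %-injective-window≤ : ∀ {N a b} .{{_ : NonZero N}} → a ≤ b → b < a + N → a % N ≡ b % N → a ≡ b
  %-injective-window≤ {N} a≤b b<a+N a%N≡b%N = %-/-injective a%N≡b%N
    (≤-antisym (/-monoˡ-≤ N a≤b) (≮⇒≥ (λ a/N<b/N → <⇒≱ b<a+N (%-gap a%N≡b%N a/N<b/N))))

%-injective-window : ∀ {N a b} .{{_ : NonZero N}} → a < b + N → b < a + N → a % N ≡ b % N → a ≡ b
%-injective-window {a = a} {b} a<b+N b<a+N a%N≡b%N with ≤-total a b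
... | inj₁ a≤b = %-injective-window≤ a≤b b<a+N a%N≡b%N
... | inj₂ b≤a = sym (%-injective-window≤ b≤a a<b+N (sym a%N≡b%N))

%-injective-shift : ∀ {N} .{{_ : NonZero N}} e {v v′} → 1 ≤ v → v ≤ N → 1 ≤ v′ → v′ ≤ N →
                    (e + v) % N ≡ (e + v′) % N → v ≡ v′
%-injective-shift {N} e 1≤v v≤N 1≤v′ v′≤N eq =
  +-cancelˡ-≡ e _ _ (%-injective-window (shifted v≤N 1≤v′) (shifted v′≤N 1≤v) eq)
  where
  shifted : ∀ {u w} → u ≤ N → 1 ≤ w → e + u < e + w + N
  shifted {u} {w} u≤N 1≤w = begin-strict
    e + u        <⟨ +-monoʳ-< e (<-≤-trans (s≤s u≤N) (+-monoˡ-≤ N 1≤w)) ⟩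
    e + (w + N)  ≡⟨ +-assoc e w N ⟨
    e + w + N    ∎
    where open ≤-Reasoning

∑< : ℕ → (ℕ → ℕ) → ℕ
∑< zero    f = 0
∑< (suc n) f = ∑< n f + f n

syntax ∑< n (λ c → e) = ∑[ c < n ] e

∑-cong : ∀ n {f g : ℕ → ℕ} → (∀ {c} → c < n → f c ≡ g c) → ∑< n f ≡ ∑< n g
∑-cong zero    f≗g = refl
∑-cong (suc n) f≗g = cong₂ _+_ (∑-cong n (f≗g ∘ m<n⇒m<1+n)) (f≗g ≤-refl)

∑-zero : ∀ n → ∑[ c < n ] 0 ≡ 0
∑-zero zero    = refl
∑-zero (suc n) = trans (+-identityʳ _) (∑-zero n)

∑-+ : ∀ n (f g : ℕ → ℕ) → ∑[ c < n ] (f c + g c) ≡ ∑< n f + ∑< n g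
∑-+ zero    f g = refl
∑-+ (suc n) f g = trans (cong (_+ (f n + g n)) (∑-+ n f g)) (+-interchange (∑< n f) (∑< n g) (f n) (g n))

∑-front : ∀ n (f : ℕ → ℕ) → ∑< (suc n) f ≡ f 0 + ∑[ c < n ] f (suc c)
∑-front zero    f = +-comm 0 (f 0)
∑-front (suc n) f = trans (cong (_+ f (suc n)) (∑-front n f)) (+-assoc (f 0) _ _)

private
  ∑-rotate₁ : ∀ n (f : ℕ → ℕ) → ∑[ c < suc n ] f (suc c % suc n) ≡ ∑< (suc n) f
  ∑-rotate₁ n f = begin
    ∑[ c < n ] f (suc c % suc n) + f (suc n % suc n)
      ≡⟨ cong₂ _+_ (∑-cong n (λ c<n → cong f (m<n⇒m%n≡m (s≤s c<n)))) (cong f (n%n≡0 (suc n))) ⟩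
    ∑[ c < n ] f (suc c) + f 0   ≡⟨ +-comm _ (f 0) ⟩
    f 0 + ∑[ c < n ] f (suc c)   ≡⟨ ∑-front n f ⟨
    ∑< (suc n) f                 ∎
    where open ≡-Reasoning

  +-%-absorbʳ : ∀ e c N .{{_ : NonZero N}} → (e + c % N) % N ≡ (e + c) % N
  +-%-absorbʳ e c N = begin
    (e + c % N) % N          ≡⟨ %-distribˡ-+ e (c % N) N ⟩
    (e % N + c % N % N) % N  ≡⟨ cong (λ r → (e % N + r) % N) (m%n%n≡m%n c N) ⟩
    (e % N + c % N) % N      ≡⟨ %-distribˡ-+ e c N ⟨
    (e + c) % N              ∎
    where open ≡-Reasoning

∑-rotate : ∀ N .{{_ : NonZero N}} e (f : ℕ → ℕ) → ∑[ c < N ] f ((e + c) % N) ≡ ∑< N f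
∑-rotate (suc n) zero    f = ∑-cong (suc n) (cong f ∘ m<n⇒m%n≡m)
∑-rotate (suc n) (suc e) f = begin
  ∑[ c < N ] f ((suc e + c) % N)      ≡⟨ ∑-cong N (λ {c} _ → cong f (shift c)) ⟩
  ∑[ c < N ] f ((e + suc c % N) % N)  ≡⟨ ∑-rotate₁ n (λ d → f ((e + d) % N)) ⟩
  ∑[ d < N ] f ((e + d) % N)          ≡⟨ ∑-rotate N e f ⟩
  ∑< N f                              ∎
  where
  open ≡-Reasoning
  N : ℕ
  N = suc n
  shift : ∀ c → (suc e + c) % N ≡ (e + suc c % N) % N
  shift c = trans (cong (_% N) (sym (+-suc e c))) (sym (+-%-absorbʳ e (suc c) N))

∑-indicator< : ∀ n t → ∑[ d < n ] countBy (_<? t) (d ∷ []) ≡ n ⊓ t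
∑-indicator< zero    t = refl
∑-indicator< (suc n) t with n <? t
... | yes n<t = begin
  ∑[ d < n ] countBy (_<? t) (d ∷ []) + countBy (_<? t) (n ∷ [])
    ≡⟨ cong₂ _+_ (∑-indicator< n t) (cong length (filter-accept (_<? t) n<t)) ⟩
  n ⊓ t + 1  ≡⟨ cong (_+ 1) (m≤n⇒m⊓n≡m (<⇒≤ n<t)) ⟩
  n + 1      ≡⟨ +-comm n 1 ⟩
  suc n      ≡⟨ m≤n⇒m⊓n≡m n<t ⟨
  suc n ⊓ t  ∎
  where open ≡-Reasoning
... | no n≮t = begin
  ∑[ d < n ] countBy (_<? t) (d ∷ []) + countBy (_<? t) (n ∷ [])
    ≡⟨ cong₂ _+_ (∑-indicator< n t) (cong length (filter-reject (_<? t) n≮t)) ⟩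
  n ⊓ t + 0  ≡⟨ +-identityʳ _ ⟩
  n ⊓ t      ≡⟨ m≥n⇒m⊓n≡n t≤n ⟩
  t          ≡⟨ m≥n⇒m⊓n≡n (m≤n⇒m≤1+n t≤n) ⟨
  suc n ⊓ t  ∎
  where
  open ≡-Reasoning
  t≤n : t ≤ n
  t≤n = ≮⇒≥ n≮t

private
  ∑-<-bound : ∀ n (f : ℕ → ℕ) w → (∀ {c} → c < n → f c < w) → ∑< n f + n ≤ n * w
  ∑-<-bound zero    f w f<w = z≤n
  ∑-<-bound (suc n) f w f<w = begin
    ∑< n f + f n + suc n    ≡⟨ swap-summands (∑< n f) (f n) n ⟩
    ∑< n f + n + suc (f n)  ≤⟨ +-mono-≤ (∑-<-bound n f w (f<w ∘ m<n⇒m<1+n)) (f<w ≤-refl) ⟩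
    n * w + w               ≡⟨ +-comm (n * w) w ⟩
    suc n * w               ∎
    where
    open ≤-Reasoning
    swap-summands : ∀ a b c → a + b + suc c ≡ a + c + suc b
    swap-summands = solve-∀

averaging : ∀ n .{{_ : NonZero n}} (f : ℕ → ℕ) w → n * w ≤ ∑< n f → ∃ λ c → c < n × w ≤ f c
averaging n f w n*w≤∑ with anyUpTo? (λ c → w ≤? f c) n
... | yes found = found
... | no none = ⊥-elim (<⇒≱ (begin-strict
  ∑< n f      <⟨ m<m+n (∑< n f) (>-nonZero⁻¹ n) ⟩
  ∑< n f + n  ≤⟨ ∑-<-bound n f w (λ {c} c<n → ≰⇒> (λ w≤fc → none (c , c<n , w≤fc))) ⟩
  n * w       ∎) n*w≤∑)
  where open ≤-Reasoning

-- Lines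

column? : (x : ℕ) → Decidable (λ (p : Point) → proj₁ p ≡ x)
column? x p = proj₁ p ≟ x

row? : (y : ℕ) → Decidable (λ (p : Point) → proj₂ p ≡ y)
row? y p = proj₂ p ≟ y

transpose : Line → Line
transpose L = line (b L) (a L) (c L) (nondeg L ∘ swap)

-- ℤ's prefix +_ is opened only in this block: elsewhere it would make sections (m +_) ambiguous.
module _ where

  open ℤ using (+_; _-_)
  import Data.Integer.Properties as ℤ
  open import Algebra.Properties.AbelianGroup ℤ.+-0-abelianGroup using (∙-cancelˡ; ∙-cancelʳ)
  open import Data.Integer.Tactic.RingSolver using () renaming (solve-∀ to ℤ-solve-∀)

  onLine-transpose : ∀ L p → OnLine (transpose L) (swap p) ⇔ OnLine L p
  onLine-transpose L (x , y) =
    mk⇔ (trans (ℤ.+-comm (a L ℤ.* + x) (b L ℤ.* + y))) (trans (ℤ.+-comm (b L ℤ.* + y) (a L ℤ.* + x)))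

  private
    onLine-equate : ∀ L {x y x′ y′} → OnLine L (x , y) → OnLine L (x′ , y′) →
                    a L ℤ.* + x ℤ.+ b L ℤ.* + y ≡ a L ℤ.* + x′ ℤ.+ b L ℤ.* + y′
    onLine-equate L on on′ = trans on (sym on′)

    *-cancel-+ : ∀ {k} m n → k ≢ + 0 → k ℤ.* + m ≡ k ℤ.* + n → m ≡ n
    *-cancel-+ {k} m n k≢0 eq = ℤ.+-injective (ℤ.*-cancelˡ-≡ k (+ m) (+ n) {{ℤ.≢-nonZero k≢0}} eq)

    -≢0 : ∀ {m n} → m ≢ n → + m - + n ≢ + 0
    -≢0 {m} {n} m≢n m-n≡0 = m≢n (ℤ.+-injective (ℤ.i-j≡0⇒i≡j (+ m) (+ n) m-n≡0))

  onLine-injˣ : ∀ L {x x′ y} → a L ≢ + 0 → OnLine L (x , y) → OnLine L (x′ , y) → x ≡ x′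
  onLine-injˣ L {x} {x′} {y} a≢0 on on′ =
    *-cancel-+ x x′ a≢0 (∙-cancelʳ (b L ℤ.* + y) _ _ (onLine-equate L on on′))

  onLine-shiftˣ : ∀ L {x x′ y} → a L ≡ + 0 → OnLine L (x , y) → OnLine L (x′ , y)
  onLine-shiftˣ L {x} {x′} {y} a≡0 on =
    trans (cong (ℤ._+ b L ℤ.* + y) (trans (a*≡0 x′) (sym (a*≡0 x)))) on
    where
    a*≡0 : ∀ z → a L ℤ.* + z ≡ + 0
    a*≡0 z = cong (ℤ._* + z) a≡0

  horizontal-sameʸ : ∀ L {p q} → a L ≡ + 0 → b L ≢ + 0 → OnLine L p → OnLine L q → proj₂ p ≡ proj₂ q
  horizontal-sameʸ L {x , y} {x′ , y′} a≡0 b≢0 on on′ =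
    *-cancel-+ y y′ b≢0 (∙-cancelˡ (a L ℤ.* + x) _ _ (onLine-equate L on (onLine-shiftˣ L a≡0 on′)))

  verticalLine : ℕ → Line
  verticalLine x₀ = line (+ 1) (+ 0) (+ x₀) (λ ())

  onVerticalLine : ∀ {x₀ p} → proj₁ p ≡ x₀ → OnLine (verticalLine x₀) p
  onVerticalLine {p = x , y} refl =
    trans (cong₂ ℤ._+_ (ℤ.*-identityˡ (+ x)) (ℤ.*-zeroˡ (+ y))) (ℤ.+-identityʳ (+ x))

  lineThrough : (p q : Point) → proj₁ p ≢ proj₁ q → Line
  lineThrough (x , y) (x′ , y′) x≢x′ =
    line (+ y′ - + y) (+ x - + x′) ((+ y′ - + y) ℤ.* + x ℤ.+ (+ x - + x′) ℤ.* + y) (-≢0 x≢x′ ∘ proj₂)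

  module _ (p q : Point) (x≢x′ : proj₁ p ≢ proj₁ q) where

    onLineThrough₁ : OnLine (lineThrough p q x≢x′) p
    onLineThrough₁ = refl

    onLineThrough₂ : OnLine (lineThrough p q x≢x′) q
    onLineThrough₂ = through (+ proj₁ p) (+ proj₂ p) (+ proj₁ q) (+ proj₂ q)
      where
      through : ∀ X Y X′ Y′ → (Y′ - Y) ℤ.* X′ ℤ.+ (X - X′) ℤ.* Y′ ≡ (Y′ - Y) ℤ.* X ℤ.+ (X - X′) ℤ.* Y
      through = ℤ-solve-∀

    lineThrough-a≢0 : proj₂ p ≢ proj₂ q → a (lineThrough p q x≢x′) ≢ + 0
    lineThrough-a≢0 y≢y′ = -≢0 (y≢y′ ∘ sym)

    lineThrough-b≢0 : b (lineThrough p q x≢x′) ≢ + 0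
    lineThrough-b≢0 = -≢0 x≢x′

horizontalLine : ℕ → Line
horizontalLine y₀ = transpose (verticalLine y₀)

onHorizontalLine : ∀ {y₀ p} → proj₂ p ≡ y₀ → OnLine (horizontalLine y₀) p
onHorizontalLine {y₀} {x , y} y≡y₀ =
  Equivalence.from (onLine-transpose (verticalLine y₀) (y , x)) (onVerticalLine {p = y , x} y≡y₀)

count-transpose : ∀ L X → count L X ≡ count (transpose L) (map swap X)
count-transpose L X = sym (trans (countBy-map (onLine? (transpose L)) swap X)
  (countBy-cong (onLine? (transpose L) ∘ swap) (onLine? L) (λ {p} → onLine-transpose L p) X))

count-horizontal : ∀ L X → a L ≡ ℤ.+ 0 → count L X ≡ countBy (λ y → onLine? L (0 , y)) (map proj₂ X)
count-horizontal L X a≡0 = sym (trans (countBy-map (λ y → onLine? L (0 , y)) proj₂ X)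
  (countBy-cong _ (onLine? L) (mk⇔ (onLine-shiftˣ L a≡0) (onLine-shiftˣ L a≡0)) X))

strip-count≤ : ∀ {N t} L {X} → a L ≢ ℤ.+ 0 → Unique X → All (λ p → N < proj₂ p × proj₂ p ≤ N + t) X →
               count L X ≤ t
strip-count≤ {N} {t} L {X} a≢0 uX strip =
  length≤-by-injection (λ p → proj₂ p ∸ suc N) t (Unique.filter⁺ (onLine? L) uX) bound inj
  where
  on⁻ : ∀ {p} → p ∈ filter (onLine? L) X → p ∈ X × OnLine L p
  on⁻ = ∈-filter⁻ (onLine? L)
  height : ∀ {p} → p ∈ filter (onLine? L) X → N < proj₂ p × proj₂ p ≤ N + t
  height = All.lookup strip ∘ proj₁ ∘ on⁻
  bound : ∀ {p} → p ∈ filter (onLine? L) X → proj₂ p ∸ suc N < t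
  bound p∈ with N<y , y≤N+t ← height p∈ = subst (_ <_) (m+n∸m≡n (suc N) t) (∸-monoˡ-< (s≤s y≤N+t) N<y)
  inj : ∀ {p q} → p ∈ filter (onLine? L) X → q ∈ filter (onLine? L) X →
        proj₂ p ∸ suc N ≡ proj₂ q ∸ suc N → p ≡ q
  inj {_ , y} p∈ q∈ eq with refl ← ∸-cancelʳ-≡ (proj₁ (height p∈)) (proj₁ (height q∈)) eq =
    cong (_, y) (onLine-injˣ L a≢0 (proj₂ (on⁻ p∈)) (proj₂ (on⁻ q∈)))

-- Stated for an abstract configuration so that, after transposing, it also covers vertical lines.
horizontal-count≤ : ∀ {N k} L → a L ≡ ℤ.+ 0 → (A R T W : List Point) →
                    All (λ p → proj₂ p ≤ N) A → All (λ p → proj₂ p ≤ N) W → All (λ p → N < proj₂ p) T →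
                    (∀ y → countBy (row? y) T ≤ k) → map proj₂ W ↭ map proj₂ R →
                    count L A + count L R ≤ k → count L A + (count L T + count L W) ≤ k
horizontal-count≤ {N} {k} L a≡0 A R T W A-low W-low T-high T-rows W↭R A+R≤k with any? (onLine? L) T
... | yes hit with q , q∈T , on-q ← find hit = begin
  count L A + (count L T + count L W)  ≡⟨ cong₂ (λ m n → m + (count L T + n)) (missed A-low) (missed W-low) ⟩
  0 + (count L T + 0)                  ≡⟨ +-identityʳ (count L T) ⟩
  count L T                            ≤⟨ countBy-mono (onLine? L) (row? (proj₂ q)) (λ on → sameʸ on on-q) T ⟩
  countBy (row? (proj₂ q)) T           ≤⟨ T-rows (proj₂ q) ⟩
  k                                    ∎
  where
  open ≤-Reasoning
  sameʸ : ∀ {p q} → OnLine L p → OnLine L q → proj₂ p ≡ proj₂ q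
  sameʸ = horizontal-sameʸ L a≡0 (λ b≡0 → nondeg L (a≡0 , b≡0))
  missed : ∀ {X} → All (λ p → proj₂ p ≤ N) X → count L X ≡ 0
  missed low = countBy-none (onLine? L)
    (All.map (λ y≤N on → <⇒≱ (All.lookup T-high q∈T) (subst (_≤ N) (sameʸ on on-q) y≤N)) low)
... | no miss = begin
  count L A + (count L T + count L W)  ≡⟨ cong (λ m → count L A + (m + count L W)) T-missed ⟩
  count L A + count L W                ≡⟨ cong (count L A +_) W≡R ⟩
  count L A + count L R                ≤⟨ A+R≤k ⟩
  k                                    ∎
  where
  open ≤-Reasoning
  T-missed : count L T ≡ 0
  T-missed = countBy-none (onLine? L) (All.¬Any⇒All¬ T miss)
  W≡R : count L W ≡ count L R
  W≡R = begin-equality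
    count L W                                        ≡⟨ count-horizontal L W a≡0 ⟩
    countBy (λ y → onLine? L (0 , y)) (map proj₂ W)  ≡⟨ countBy-↭ (λ y → onLine? L (0 , y)) W↭R ⟩
    countBy (λ y → onLine? L (0 , y)) (map proj₂ R)  ≡⟨ count-horizontal L R a≡0 ⟨
    count L R                                        ∎

-- Anti-diagonal bands

module Band (N t : ℕ) .{{_ : NonZero N}} where

  offset : ℕ → Point → ℕ
  offset c (x , y) = (x + y + c) % N

  inBand? : ∀ c → Decidable (λ p → offset c p < t)
  inBand? c p = offset c p <? t

  private
    bandCount : ∀ c {X : List Point} X′ → (∀ {p} → p ∈ X′ → p ∈ X) → Unique X′ →
                All (λ p → offset c p < t) X →
                (∀ {p q} → p ∈ X′ → q ∈ X′ → offset c p ≡ offset c q → p ≡ q) → length X′ ≤ t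
    bandCount c X′ X′⊆X uX′ inBand inj =
      length≤-by-injection (offset c) t uX′ (λ p∈X′ → All.lookup inBand (X′⊆X p∈X′)) inj

  column≤ : ∀ c x {X} → Unique X → All (InGrid N) X → All (λ p → offset c p < t) X →
            countBy (column? x) X ≤ t
  column≤ c x {X} uX grid inBand =
    bandCount c _ (proj₁ ∘ ∈-filter⁻ (column? x)) (Unique.filter⁺ (column? x) uX) inBand inj
    where
    inj : ∀ {p q} → p ∈ filter (column? x) X → q ∈ filter (column? x) X → offset c p ≡ offset c q → p ≡ q
    inj {_ , y} {_ , y′} p∈ q∈ eq
      with p∈X , refl ← ∈-filter⁻ (column? x) p∈ | q∈X , refl ← ∈-filter⁻ (column? x) q∈
      with _ , 1≤y , y≤N ← All.lookup grid p∈X | _ , 1≤y′ , y′≤N ← All.lookup grid q∈X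
      = cong (x ,_) (%-injective-shift (x + c) 1≤y y≤N 1≤y′ y′≤N
          (trans (cong (_% N) (sym (xy∙z≈xz∙y x y c))) (trans eq (cong (_% N) (xy∙z≈xz∙y x y′ c)))))

  row≤ : ∀ c y {X} → Unique X → All (InGrid N) X → All (λ p → offset c p < t) X →
         countBy (row? y) X ≤ t
  row≤ c y {X} uX grid inBand =
    bandCount c _ (proj₁ ∘ ∈-filter⁻ (row? y)) (Unique.filter⁺ (row? y) uX) inBand inj
    where
    inj : ∀ {p q} → p ∈ filter (row? y) X → q ∈ filter (row? y) X → offset c p ≡ offset c q → p ≡ q
    inj {x , _} {x′ , _} p∈ q∈ eq
      with p∈X , refl ← ∈-filter⁻ (row? y) p∈ | q∈X , refl ← ∈-filter⁻ (row? y) q∈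
      with (1≤x , x≤N) , _ ← All.lookup grid p∈X | (1≤x′ , x′≤N) , _ ← All.lookup grid q∈X
      = cong (_, y) (%-injective-shift (y + c) 1≤x x≤N 1≤x′ x′≤N
          (trans (cong (_% N) (sym (xy∙z≈yz∙x x y c))) (trans eq (cong (_% N) (xy∙z≈yz∙x x′ y c)))))

  module _ (t≤N : t ≤ N) where

    bandWeight : ∀ p → ∑[ c < N ] countBy (inBand? c) (p ∷ []) ≡ t
    bandWeight p@(x , y) = begin
      ∑[ c < N ] countBy (inBand? c) (p ∷ [])
        ≡⟨ ∑-cong N (λ {c} _ → countBy-map (_<? t) (offset c) (p ∷ [])) ⟨
      ∑[ c < N ] countBy (_<? t) ((x + y + c) % N ∷ [])
        ≡⟨ ∑-rotate N (x + y) (λ d → countBy (_<? t) (d ∷ [])) ⟩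
      ∑[ d < N ] countBy (_<? t) (d ∷ [])  ≡⟨ ∑-indicator< N t ⟩
      N ⊓ t                                ≡⟨ m≥n⇒m⊓n≡n t≤N ⟩
      t                                    ∎
      where open ≡-Reasoning

    totalBandWeight : ∀ X → ∑[ c < N ] countBy (inBand? c) X ≡ length X * t
    totalBandWeight [] = ∑-zero N
    totalBandWeight (p ∷ X) = begin
      ∑[ c < N ] countBy (inBand? c) (p ∷ X)
        ≡⟨ ∑-cong N (λ {c} _ → countBy-++ (inBand? c) (p ∷ []) X) ⟩
      ∑[ c < N ] (countBy (inBand? c) (p ∷ []) + countBy (inBand? c) X)
        ≡⟨ ∑-+ N (λ c → countBy (inBand? c) (p ∷ [])) (λ c → countBy (inBand? c) X) ⟩
      ∑[ c < N ] countBy (inBand? c) (p ∷ []) + ∑[ c < N ] countBy (inBand? c) X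
        ≡⟨ cong₂ _+_ (bandWeight p) (totalBandWeight X) ⟩
      t + length X * t
        ∎
      where open ≡-Reasoning

record Selection (k t : ℕ) (X : List Point) : Set where
  field
    points  : List Point
    unique  : Unique points
    ⊆X      : All (_∈ X) points
    size    : length points ≡ k * t
    columns : ∀ x → countBy (column? x) points ≤ t
    rows    : ∀ y → countBy (row? y) points ≤ t

select : ∀ {N t k X} .{{_ : NonZero N}} → t ≤ N → Unique X → All (InGrid N) X → length X ≡ k * N →
         Selection k t X
select {N} {t} {k} {X} t≤N uX grid |X|≡kN = record
  { points  = R
  ; unique  = uR
  ; ⊆X      = R⊆X
  ; size    = trans (length-take (k * t) _) (m≤n⇒m⊓n≡m (proj₂ (proj₂ heavy)))
  ; columns = λ x → column≤ c₀ x uR gridR R-inBand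
  ; rows    = λ y → row≤ c₀ y uR gridR R-inBand
  }
  where
  open Band N t
  N*kt≤∑ : N * (k * t) ≤ ∑[ c < N ] countBy (inBand? c) X
  N*kt≤∑ = ≤-reflexive (begin
    N * (k * t)                       ≡⟨ *-assoc N k t ⟨
    N * k * t                         ≡⟨ cong (_* t) (trans (*-comm N k) (sym |X|≡kN)) ⟩
    length X * t                      ≡⟨ totalBandWeight t≤N X ⟨
    ∑[ c < N ] countBy (inBand? c) X  ∎)
    where open ≡-Reasoning
  heavy : ∃ λ c → c < N × k * t ≤ countBy (inBand? c) X
  heavy = averaging N (λ c → countBy (inBand? c) X) (k * t) N*kt≤∑
  c₀ : ℕ
  c₀ = proj₁ heavy
  R : List Point
  R = take (k * t) (filter (inBand? c₀) X)
  uR : Unique R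
  uR = Unique.take⁺ (k * t) (Unique.filter⁺ (inBand? c₀) uX)
  R⊆X : All (_∈ X) R
  R⊆X = All.take⁺ (k * t) (All.filter⁺ (inBand? c₀) (All.tabulate (λ p∈X → p∈X)))
  R-inBand : All (λ p → offset c₀ p < t) R
  R-inBand = All.take⁺ (k * t) (All.all-filter (inBand? c₀) X)
  gridR : All (InGrid N) R
  gridR = All.map (All.lookup grid) R⊆X

-- Stacking into a strip

range : ℕ → ℕ → List ℕ
range i zero    = []
range i (suc m) = i ∷ range (suc i) m

∈-range⁻ : ∀ {i m j} → j ∈ range i m → i ≤ j × j < i + m
∈-range⁻ {i} {suc m} (here refl) = ≤-refl , m<m+n i z<s
∈-range⁻ {i} {suc m} {j} (there j∈) with i<j , j<1+i+m ← ∈-range⁻ j∈ =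
  <⇒≤ i<j , subst (j <_) (sym (+-suc i m)) j<1+i+m

range-unique : ∀ i m → Unique (range i m)
range-unique i zero    = []
range-unique i (suc m) =
  All.tabulate (λ j∈ i≡j → <-irrefl i≡j (proj₁ (∈-range⁻ j∈))) ∷ range-unique (suc i) m

byColumns : List ℕ → List Point → List Point
byColumns cs R = concatMap (λ x → filter (column? x) R) cs

module _ (R : List Point) where

  ∈-byColumns⁻ : ∀ {cs p} → p ∈ byColumns cs R → p ∈ R × proj₁ p ∈ cs
  ∈-byColumns⁻ {x ∷ cs} p∈ with ∈-++⁻ (filter (column? x) R) p∈
  ... | inj₁ p∈col with p∈R , refl ← ∈-filter⁻ (column? x) p∈col = p∈R , here refl
  ... | inj₂ p∈rest with p∈R , x∈cs ← ∈-byColumns⁻ {cs} p∈rest = p∈R , there x∈cs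

  ∈-byColumns⁺ : ∀ {cs p} → p ∈ R → proj₁ p ∈ cs → p ∈ byColumns cs R
  ∈-byColumns⁺ {x ∷ cs} p∈R (here refl)  = ∈-++⁺ˡ (∈-filter⁺ (column? x) p∈R refl)
  ∈-byColumns⁺ {x ∷ cs} p∈R (there x∈cs) = ∈-++⁺ʳ (filter (column? x) R) (∈-byColumns⁺ p∈R x∈cs)

  byColumns-unique : ∀ {cs} → Unique cs → Unique R → Unique (byColumns cs R)
  byColumns-unique [] _ = []
  byColumns-unique {x ∷ cs} (x∉cs ∷ ucs) uR =
    Unique.++⁺ (Unique.filter⁺ (column? x) uR) (byColumns-unique ucs uR) disjoint
    where
    disjoint : ∀ {p} → ¬ (p ∈ filter (column? x) R × p ∈ byColumns cs R)
    disjoint (p∈col , p∈rest) with _ , refl ← ∈-filter⁻ (column? x) {xs = R} p∈col =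
      All.lookup x∉cs (proj₂ (∈-byColumns⁻ {cs} p∈rest)) refl

  byColumns-↭ : ∀ {cs} → Unique cs → Unique R → All (λ p → proj₁ p ∈ cs) R → byColumns cs R ↭ R
  byColumns-↭ {cs} ucs uR cols = unique∧set⇒↭ (byColumns-unique ucs uR) uR
    (mk⇔ (proj₁ ∘ ∈-byColumns⁻ {cs}) (λ p∈R → ∈-byColumns⁺ p∈R (All.lookup cols p∈R)))

InTopStrip : ℕ → ℕ → Point → Set
InTopStrip N t (x , y) = (1 ≤ x × x ≤ N) × (N < y × y ≤ N + t)

module Stacking (N t : ℕ) .{{_ : NonZero t}} where

  level : ℕ → ℕ
  level i = suc (N + i % t)

  stackFrom : ℕ → List Point → List Point
  stackFrom i []             = []
  stackFrom i ((x , _) ∷ ps) = (x , level i) ∷ stackFrom (suc i) ps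

  map-proj₁-stackFrom : ∀ i ps → map proj₁ (stackFrom i ps) ≡ map proj₁ ps
  map-proj₁-stackFrom i []             = refl
  map-proj₁-stackFrom i ((x , _) ∷ ps) = cong (x ∷_) (map-proj₁-stackFrom (suc i) ps)

  map-proj₂-stackFrom : ∀ i ps → map proj₂ (stackFrom i ps) ≡ map level (range i (length ps))
  map-proj₂-stackFrom i []       = refl
  map-proj₂-stackFrom i (_ ∷ ps) = cong (level i ∷_) (map-proj₂-stackFrom (suc i) ps)

  stackFrom-++ : ∀ i ps qs → stackFrom i (ps ++ qs) ≡ stackFrom i ps ++ stackFrom (i + length ps) qs
  stackFrom-++ i [] qs = cong (λ j → stackFrom j qs) (sym (+-identityʳ i))
  stackFrom-++ i ((x , _) ∷ ps) qs = cong ((x , level i) ∷_) (trans (stackFrom-++ (suc i) ps qs)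
    (cong (λ j → stackFrom (suc i) ps ++ stackFrom j qs) (sym (+-suc i (length ps)))))

  ∈-stackFrom⁻ : ∀ {i ps q} → q ∈ stackFrom i ps →
                 ∃₂ λ p j → p ∈ ps × j ∈ range i (length ps) × q ≡ (proj₁ p , level j)
  ∈-stackFrom⁻ {ps = _ ∷ _} (here refl) = _ , _ , here refl , here refl , refl
  ∈-stackFrom⁻ {ps = _ ∷ _} (there q∈) with p , j , p∈ , j∈ , eq ← ∈-stackFrom⁻ q∈ =
    p , j , there p∈ , there j∈ , eq

  stackFrom-inStrip : ∀ i {ps} → All (λ p → 1 ≤ proj₁ p × proj₁ p ≤ N) ps →
                      All (InTopStrip N t) (stackFrom i ps)
  stackFrom-inStrip i []           = []
  stackFrom-inStrip i (col ∷ cols) = (col , s≤s (m≤m+n N _) , level≤) ∷ stackFrom-inStrip (suc i) cols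
    where
    level≤ : level i ≤ N + t
    level≤ = subst (_≤ N + t) (+-suc N (i % t)) (+-monoʳ-≤ N (m%n<n i t))

  private
    level-injective : ∀ {i j} → level i ≡ level j → i % t ≡ j % t
    level-injective eq = +-cancelˡ-≡ N _ _ (suc-injective eq)

  stackFrom-unique-window : ∀ i ps → length ps ≤ t → Unique (stackFrom i ps)
  stackFrom-unique-window i [] _ = []
  stackFrom-unique-window i ((x , _) ∷ ps) 1+len≤t =
    All.tabulate distinct ∷ stackFrom-unique-window (suc i) ps (≤-trans (n≤1+n _) 1+len≤t)
    where
    distinct : ∀ {q} → q ∈ stackFrom (suc i) ps → (x , level i) ≢ q
    distinct q∈ eq with _ , j , _ , j∈ , refl ← ∈-stackFrom⁻ q∈ with i<j , j<1+i+len ← ∈-range⁻ j∈ =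
      <-irrefl (%-injective-window (<-≤-trans i<j (m≤m+n j t)) j<i+t (level-injective (cong proj₂ eq))) i<j
      where
      j<i+t : j < i + t
      j<i+t = <-≤-trans j<1+i+len (subst (_≤ i + t) (+-suc i (length ps)) (+-monoʳ-≤ i 1+len≤t))

  stackFrom-byColumns-unique : ∀ i {cs R} → Unique cs → Unique R → (∀ x → countBy (column? x) R ≤ t) →
                               Unique (stackFrom i (byColumns cs R))
  stackFrom-byColumns-unique i [] _ _ = []
  stackFrom-byColumns-unique i {x ∷ cs} {R} (x∉cs ∷ ucs) uR cols =
    subst Unique (sym (stackFrom-++ i column (byColumns cs R)))
      (Unique.++⁺ (stackFrom-unique-window i column (cols x)) (stackFrom-byColumns-unique _ ucs uR cols) disjoint)
    where
    column : List Point
    column = filter (column? x) R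
    disjoint : ∀ {q} → ¬ (q ∈ stackFrom i column × q ∈ stackFrom (i + length column) (byColumns cs R))
    disjoint (q∈₁ , q∈₂)
      with p , _ , p∈column , _ , refl ← ∈-stackFrom⁻ q∈₁ | p′ , _ , p′∈rest , _ , eq ← ∈-stackFrom⁻ q∈₂
      with _ , refl ← ∈-filter⁻ (column? x) {xs = R} p∈column =
      All.lookup x∉cs (subst (_∈ cs) (sym (cong proj₁ eq)) (proj₂ (∈-byColumns⁻ R {cs} p′∈rest))) refl

  countBy-row-stackFrom : ∀ y i ps →
                          countBy (row? y) (stackFrom i ps) ≡ countBy (λ j → level j ≟ y) (range i (length ps))
  countBy-row-stackFrom y i ps = begin
    countBy (row? y) (stackFrom i ps)                  ≡⟨ countBy-map (_≟ y) proj₂ (stackFrom i ps) ⟨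
    countBy (_≟ y) (map proj₂ (stackFrom i ps))        ≡⟨ cong (countBy (_≟ y)) (map-proj₂-stackFrom i ps) ⟩
    countBy (_≟ y) (map level (range i (length ps)))   ≡⟨ countBy-map (_≟ y) level (range i (length ps)) ⟩
    countBy (λ j → level j ≟ y) (range i (length ps))  ∎
    where open ≡-Reasoning

  countBy-level≤ : ∀ y k → countBy (λ j → level j ≟ y) (range 0 (k * t)) ≤ k
  countBy-level≤ y k =
    length≤-by-injection (_/ t) k (Unique.filter⁺ (λ j → level j ≟ y) (range-unique 0 (k * t)))
      (λ j∈ → m<n*o⇒m/o<n (proj₂ (∈-range⁻ (proj₁ (at-level⁻ j∈)))))
      (λ j∈ j′∈ → %-/-injective (level-injective (trans (proj₂ (at-level⁻ j∈)) (sym (proj₂ (at-level⁻ j′∈))))))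
    where
    at-level⁻ : ∀ {j} → j ∈ filter (λ j → level j ≟ y) (range 0 (k * t)) →
                j ∈ range 0 (k * t) × level j ≡ y
    at-level⁻ = ∈-filter⁻ (λ j → level j ≟ y)

  stack : List Point → List Point
  stack R = stackFrom 0 (byColumns (upTo (suc N)) R)

  module _ {R} (uR : Unique R) (grid : All (InGrid N) R) where

    private
      sorted : List Point
      sorted = byColumns (upTo (suc N)) R
      sorted↭ : sorted ↭ R
      sorted↭ = byColumns-↭ R (Unique.upTo⁺ (suc N)) uR
                  (All.map (λ g → ∈-upTo⁺ (s≤s (proj₂ (proj₁ g)))) grid)

    stack-unique : (∀ x → countBy (column? x) R ≤ t) → Unique (stack R)
    stack-unique = stackFrom-byColumns-unique 0 (Unique.upTo⁺ (suc N)) uR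

    stack-columns : map proj₁ (stack R) ↭ map proj₁ R
    stack-columns =
      subst (_↭ map proj₁ R) (sym (map-proj₁-stackFrom 0 sorted)) (↭.map⁺ proj₁ sorted↭)

    stack-length : length (stack R) ≡ length R
    stack-length = trans (sym (length-map proj₁ (stack R))) (trans (↭.↭-length stack-columns) (length-map proj₁ R))

    stack-inStrip : All (InTopStrip N t) (stack R)
    stack-inStrip =
      stackFrom-inStrip 0 (All.tabulate (λ p∈ → proj₁ (All.lookup grid (proj₁ (∈-byColumns⁻ R {cs = upTo (suc N)} p∈)))))

    stack-rows : ∀ {k} → length R ≡ k * t → ∀ y → countBy (row? y) (stack R) ≤ k
    stack-rows {k} |R|≡kt y = begin
      countBy (row? y) (stack R)
        ≡⟨ countBy-row-stackFrom y 0 sorted ⟩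
      countBy (λ j → level j ≟ y) (range 0 (length sorted))
        ≡⟨ cong (countBy (λ j → level j ≟ y) ∘ range 0) |sorted|≡kt ⟩
      countBy (λ j → level j ≟ y) (range 0 (k * t))
        ≤⟨ countBy-level≤ y k ⟩
      k ∎
      where
      open ≤-Reasoning
      |sorted|≡kt : length sorted ≡ k * t
      |sorted|≡kt = trans (↭.↭-length sorted↭) |R|≡kt

-- Full reserve

private
  spanned-by-one-axis : ∀ (f g : Point → ℕ) {S p q} → (∀ {r s} → f r ≡ f s → g r ≡ g s → r ≡ s) →
                        (∀ {r s} → r ∈ S → s ∈ S → f r ≡ f s ⊎ g r ≡ g s) →
                        p ∈ S → q ∈ S → p ≢ q → f p ≡ f q → All (λ r → f r ≡ f p) S
  spanned-by-one-axis f g {S} {p} {q} inj shares p∈S q∈S p≢q fp≡fq = All.tabulate onAxis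
    where
    onAxis : ∀ {r} → r ∈ S → f r ≡ f p
    onAxis r∈S with shares r∈S p∈S | shares r∈S q∈S
    ... | inj₁ fr≡fp | _          = fr≡fp
    ... | inj₂ _     | inj₁ fr≡fq = trans fr≡fq (sym fp≡fq)
    ... | inj₂ gr≡gp | inj₂ gr≡gq = ⊥-elim (p≢q (inj fp≡fq (trans (sym gr≡gp) gr≡gq)))

fullReserve-impossible : ∀ {k N S} → 1 < k → k ≤ N → NoInLine k N S → length S ≡ k * N →
                         HasReserve k k N S → ⊥
fullReserve-impossible {k} {N} {S} 1<k k≤N (uS , grid , lines) |S|≡kN reserve = <⇒≱ k<|S| |S|≤k
  where
  instance
    k≢0 : NonZero k
    k≢0 = >-nonZero (<-trans z<s 1<k)

  k<|S| : k < length S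
  k<|S| = subst (k <_) (sym |S|≡kN) (m<m*n k N (<-≤-trans 1<k k≤N))

  shares : ∀ {r s} → r ∈ S → s ∈ S → proj₁ r ≡ proj₁ s ⊎ proj₂ r ≡ proj₂ s
  shares {r} {s} r∈S s∈S with proj₁ r ≟ proj₁ s | proj₂ r ≟ proj₂ s
  ... | yes x≡x′ | _        = inj₁ x≡x′
  ... | no _     | yes y≡y′ = inj₂ y≡y′
  ... | no x≢x′  | no y≢y′  = ⊥-elim (2≰0 (≤-trans 2≤count (subst (count L S ≤_) (n∸n≡0 k) count≤0)))
    where
    L : Line
    L = lineThrough r s x≢x′
    r≢s : r ≢ s
    r≢s = x≢x′ ∘ cong proj₁
    2≰0 : ¬ (2 ≤ 0)
    2≰0 ()
    2≤count : 2 ≤ count L S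
    2≤count = pair⇒2≤countBy (onLine? L) r≢s r∈S s∈S (onLineThrough₁ r s x≢x′) (onLineThrough₂ r s x≢x′)
    count≤0 : count L S ≤ k ∸ k
    count≤0 = reserve L (lineThrough-a≢0 r s x≢x′ y≢y′) (lineThrough-b≢0 r s x≢x′)
      (r , s , r≢s , All.lookup grid r∈S , All.lookup grid s∈S ,
       onLineThrough₁ r s x≢x′ , onLineThrough₂ r s x≢x′)

  |S|≤k : length S ≤ k
  |S|≤k with p , q , p≢q , p∈S , q∈S ← 2≤length⇒pair uS (≤-trans (s≤s (>-nonZero⁻¹ k)) k<|S|)
             | shares p∈S q∈S
  ... | inj₁ x≡x′ = subst (_≤ k) (countBy-all (onLine? L) (All.map (λ {r} → onVerticalLine {p = r}) vertical)) (lines L)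
    where
    L : Line
    L = verticalLine (proj₁ p)
    vertical : All (λ r → proj₁ r ≡ proj₁ p) S
    vertical = spanned-by-one-axis proj₁ proj₂ (cong₂ _,_) shares p∈S q∈S p≢q x≡x′
  ... | inj₂ y≡y′ =
    subst (_≤ k) (countBy-all (onLine? L) (All.map (λ {r} → onHorizontalLine {p = r}) horizontal)) (lines L)
    where
    L : Line
    L = horizontalLine (proj₂ p)
    horizontal : All (λ r → proj₂ r ≡ proj₂ p) S
    horizontal = spanned-by-one-axis proj₂ proj₁ (λ y≡y′ x≡x′ → cong₂ _,_ x≡x′ y≡y′)
                   (λ r∈S s∈S → Sum.swap (shares r∈S s∈S)) p∈S q∈S p≢q y≡y′

-- The extension

private
  map-swap-involutive : ∀ (X : List Point) → map swap (map swap X) ≡ X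
  map-swap-involutive X = trans (sym (map-∘ X)) (map-id X)

  map-proj₂-swap : ∀ (X : List Point) → map proj₂ (map swap X) ≡ map proj₁ X
  map-proj₂-swap X = sym (map-∘ {g = proj₂} {f = swap} X)

  map-proj₁-swap : ∀ (X : List Point) → map proj₁ (map swap X) ≡ map proj₂ X
  map-proj₁-swap X = sym (map-∘ {g = proj₁} {f = swap} X)

  swap-injective : ∀ {p q : Point} → swap p ≡ swap q → p ≡ q
  swap-injective = cong swap

module Extension {N t k} .{{_ : NonZero N}} .{{_ : NonZero t}}
  (S : List Point) (uS : Unique S) (grid : All (InGrid N) S) (lines : ∀ L → count L S ≤ k)
  (|S|≡kN : length S ≡ k * N) (reserve : HasReserve (t * 2) k N S) (2t<k : t * 2 < k)
  (sel : Selection k t S) where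

  open Selection sel
    renaming (points to R; unique to uR; ⊆X to R⊆S; size to |R|≡kt; columns to R-columns; rows to R-rows)
  open Stacking N t

  R′ kept top right S″ : List Point
  R′    = map swap R
  kept  = filter (λ p → ¬? (p ∈? R)) S
  top   = stack R
  right = map swap (stack R′)
  S″    = kept ++ top ++ right

  private
    gridR : All (InGrid N) R
    gridR = All.map (All.lookup grid) R⊆S

    uR′ : Unique R′
    uR′ = Unique.map⁺ swap-injective uR

    gridR′ : All (InGrid N) R′
    gridR′ = All.map⁺ (All.map swap gridR)

    R′-columns : ∀ x → countBy (column? x) R′ ≤ t
    R′-columns x = subst (_≤ t) (sym (countBy-map (column? x) swap R)) (R-rows x)

    kept-grid : All (InGrid N) kept
    kept-grid = All.filter⁺ (λ p → ¬? (p ∈? R)) grid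

    top-unique : Unique top
    top-unique = stack-unique uR gridR R-columns

    swapped-unique : Unique (stack R′)
    swapped-unique = stack-unique uR′ gridR′ R′-columns

    top-strip : All (InTopStrip N t) top
    top-strip = stack-inStrip uR gridR

    swapped-strip : All (InTopStrip N t) (stack R′)
    swapped-strip = stack-inStrip uR′ gridR′

    right-strip : All (InTopStrip N t ∘ swap) right
    right-strip = All.map⁺ swapped-strip

  S↭kept++R : S ↭ kept ++ R
  S↭kept++R = unique∧set⇒↭ uS (Unique.++⁺ (Unique.filter⁺ (λ p → ¬? (p ∈? R)) uS) uR disjoint)
                               (mk⇔ split merge)
    where
    kept⁻ : ∀ {p} → p ∈ kept → p ∈ S × ¬ p ∈ R
    kept⁻ = ∈-filter⁻ (λ p → ¬? (p ∈? R))
    disjoint : ∀ {p} → ¬ (p ∈ kept × p ∈ R)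
    disjoint (p∈kept , p∈R) = proj₂ (kept⁻ p∈kept) p∈R
    split : ∀ {p} → p ∈ S → p ∈ kept ++ R
    split {p} p∈S with p ∈? R
    ... | yes p∈R = ∈-++⁺ʳ kept p∈R
    ... | no p∉R  = ∈-++⁺ˡ (∈-filter⁺ (λ p → ¬? (p ∈? R)) p∈S p∉R)
    merge : ∀ {p} → p ∈ kept ++ R → p ∈ S
    merge p∈ with ∈-++⁻ kept p∈
    ... | inj₁ p∈kept = proj₁ (kept⁻ p∈kept)
    ... | inj₂ p∈R    = All.lookup R⊆S p∈R

  count-kept+R : ∀ L → count L kept + count L R ≡ count L S
  count-kept+R L = sym (trans (countBy-↭ (onLine? L) S↭kept++R) (countBy-++ (onLine? L) kept R))

  count-right : ∀ L → count L right ≡ count (transpose L) (stack R′)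
  count-right L = trans (count-transpose L right) (cong (count (transpose L)) (map-swap-involutive (stack R′)))

  countParts : Line → ℕ
  countParts L = count L kept + (count L top + count L right)

  oblique-case : ∀ L → a L ≢ ℤ.+ 0 → b L ≢ ℤ.+ 0 → countParts L ≤ k
  oblique-case L a≢0 b≢0 = begin
    count L kept + (count L top + count L right)  ≤⟨ +-mono-≤ kept≤S (+-mono-≤ top≤t right≤t) ⟩
    count L S + (t + t)                           ≡⟨ cong (count L S +_) t+t≡t*2 ⟩
    count L S + t * 2                             ≤⟨ S+2t≤k ⟩
    k                                             ∎
    where
    open ≤-Reasoning
    kept≤S : count L kept ≤ count L S
    kept≤S = subst (count L kept ≤_) (count-kept+R L) (m≤m+n _ _)
    top≤t : count L top ≤ t
    top≤t = strip-count≤ L a≢0 top-unique (All.map proj₂ top-strip)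
    right≤t : count L right ≤ t
    right≤t = subst (_≤ t) (sym (count-right L))
      (strip-count≤ (transpose L) b≢0 swapped-unique (All.map proj₂ swapped-strip))
    t+t≡t*2 : t + t ≡ t * 2
    t+t≡t*2 = trans (cong (t +_) (sym (*-identityʳ t))) (sym (*-suc t 1))
    S+2t≤k : count L S + t * 2 ≤ k
    S+2t≤k with 2 ≤? count L S
    ... | no 2≰count = ≤-trans (+-monoˡ-≤ (t * 2) (≤-pred (≰⇒> 2≰count))) 2t<k
    ... | yes 2≤count with p , q , p≢q , p∈S , q∈S , on-p , on-q ← 2≤countBy⇒pair (onLine? L) uS 2≤count =
      ≤-trans (+-monoˡ-≤ (t * 2) (reserve L a≢0 b≢0 (p , q , p≢q , All.lookup grid p∈S , All.lookup grid q∈S ,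
                                                     on-p , on-q)))
              (≤-reflexive (m∸n+n≡m (<⇒≤ 2t<k)))

  horizontal-case : ∀ L → a L ≡ ℤ.+ 0 → countParts L ≤ k
  horizontal-case L a≡0 = horizontal-count≤ L a≡0 kept R top right
    (All.map (λ g → proj₂ (proj₂ g)) kept-grid)
    (All.map⁺ (All.map (λ g → proj₂ (proj₁ g)) swapped-strip))
    (All.map (λ g → proj₁ (proj₂ g)) top-strip)
    (stack-rows uR gridR |R|≡kt)
    (subst₂ _↭_ (sym (map-proj₂-swap (stack R′))) (map-proj₁-swap R) (stack-columns uR′ gridR′))
    (subst (_≤ k) (sym (count-kept+R L)) (lines L))

  vertical-case : ∀ L → b L ≡ ℤ.+ 0 → countParts L ≤ k
  vertical-case L b≡0 = subst (_≤ k) transposed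
    (horizontal-count≤ (transpose L) b≡0 (map swap kept) R′ (stack R′) (map swap top)
      (All.map⁺ (All.map (λ g → proj₂ (proj₁ g)) kept-grid))
      (All.map⁺ (All.map (λ g → proj₂ (proj₁ g)) top-strip))
      (All.map (λ g → proj₁ (proj₂ g)) swapped-strip)
      (stack-rows uR′ gridR′ (trans (length-map swap R) |R|≡kt))
      (subst₂ _↭_ (sym (map-proj₂-swap top)) (sym (map-proj₂-swap R)) (stack-columns uR gridR))
      (subst (_≤ k) (trans (sym (count-kept+R L)) (cong₂ _+_ (count-transpose L kept) (count-transpose L R)))
                    (lines L)))
    where
    L′ : Line
    L′ = transpose L
    transposed : count L′ (map swap kept) + (count L′ (stack R′) + count L′ (map swap top)) ≡ countParts L
    transposed = cong₂ _+_ (sym (count-transpose L kept))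
      (trans (+-comm (count L′ (stack R′)) _) (cong₂ _+_ (sym (count-transpose L top)) (sym (count-right L))))

  line-count≤ : ∀ L → count L S″ ≤ k
  line-count≤ L = subst (_≤ k) (sym count-S″) (by-direction (a L ℤ.≟ ℤ.+ 0) (b L ℤ.≟ ℤ.+ 0))
    where
    count-S″ : count L S″ ≡ countParts L
    count-S″ = trans (countBy-++ (onLine? L) kept _) (cong (count L kept +_) (countBy-++ (onLine? L) top right))
    by-direction : Dec (a L ≡ ℤ.+ 0) → Dec (b L ≡ ℤ.+ 0) → countParts L ≤ k
    by-direction (yes a≡0) _         = horizontal-case L a≡0
    by-direction (no _)    (yes b≡0) = vertical-case L b≡0
    by-direction (no a≢0)  (no b≢0)  = oblique-case L a≢0 b≢0

  S″-grid : All (InGrid (N + t)) S″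
  S″-grid = All.++⁺ (All.map widen kept-grid)
                    (All.++⁺ (All.map strip⇒grid top-strip) (All.map (swap ∘ strip⇒grid) right-strip))
    where
    N≤N+t : N ≤ N + t
    N≤N+t = m≤m+n N t
    widen : ∀ {p} → InGrid N p → InGrid (N + t) p
    widen ((1≤x , x≤N) , (1≤y , y≤N)) = (1≤x , ≤-trans x≤N N≤N+t) , (1≤y , ≤-trans y≤N N≤N+t)
    strip⇒grid : ∀ {p} → InTopStrip N t p → InGrid (N + t) p
    strip⇒grid ((1≤x , x≤N) , (N<y , y≤N+t)) = (1≤x , ≤-trans x≤N N≤N+t) , (≤-trans (s≤s z≤n) N<y , y≤N+t)

  S″-unique : Unique S″
  S″-unique = Unique.++⁺ (Unique.filter⁺ (λ p → ¬? (p ∈? R)) uS)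
    (Unique.++⁺ top-unique (Unique.map⁺ swap-injective swapped-unique) top∩right) kept∩new
    where
    top∩right : ∀ {p} → ¬ (p ∈ top × p ∈ right)
    top∩right (p∈top , p∈right) =
      <⇒≱ (proj₁ (proj₂ (All.lookup right-strip p∈right))) (proj₂ (proj₁ (All.lookup top-strip p∈top)))
    kept∩new : ∀ {p} → ¬ (p ∈ kept × p ∈ top ++ right)
    kept∩new (p∈kept , p∈new) with ∈-++⁻ top p∈new
    ... | inj₁ p∈top =
      <⇒≱ (proj₁ (proj₂ (All.lookup top-strip p∈top))) (proj₂ (proj₂ (All.lookup kept-grid p∈kept)))
    ... | inj₂ p∈right =
      <⇒≱ (proj₁ (proj₂ (All.lookup right-strip p∈right))) (proj₂ (proj₁ (All.lookup kept-grid p∈kept)))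

  S″-size : length S″ ≡ k * (N + t)
  S″-size = begin
    length (kept ++ top ++ right)              ≡⟨ length-++ kept ⟩
    length kept + length (top ++ right)        ≡⟨ cong (length kept +_) (length-++ top) ⟩
    length kept + (length top + length right)  ≡⟨ cong₂ (λ m n → length kept + (m + n)) top-size right-size ⟩
    length kept + (k * t + k * t)              ≡⟨ +-assoc (length kept) _ _ ⟨
    length kept + k * t + k * t                ≡⟨ cong (_+ k * t) kept-size ⟩
    k * N + k * t                              ≡⟨ *-distribˡ-+ k N t ⟨
    k * (N + t)                                ∎
    where
    open ≡-Reasoning
    top-size : length top ≡ k * t
    top-size = trans (stack-length uR gridR) |R|≡kt
    right-size : length right ≡ k * t
    right-size =
      trans (length-map swap (stack R′)) (trans (stack-length uR′ gridR′) (trans (length-map swap R) |R|≡kt))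
    kept-size : length kept + k * t ≡ k * N
    kept-size = begin
      length kept + k * t     ≡⟨ cong (length kept +_) |R|≡kt ⟨
      length kept + length R  ≡⟨ length-++ kept ⟨
      length (kept ++ R)      ≡⟨ ↭.↭-length S↭kept++R ⟨
      length S                ≡⟨ |S|≡kN ⟩
      k * N                   ∎

  extended : NoInLine k (N + t) S″ × length S″ ≡ k * (N + t)
  extended = (S″-unique , S″-grid , line-count≤) , S″-size

reserveExtension : ∀ {k N} t .{{_ : NonZero t}} → t * 2 < k → k ≤ N → ∀ {S} → NoInLine k N S →
                   length S ≡ k * N → HasReserve (t * 2) k N S →
                   Σ (List Point) λ S″ → NoInLine k (N + t) S″ × length S″ ≡ k * (N + t)
reserveExtension {k} {N} t 2t<k k≤N {S} (uS , grid , lines) |S|≡kN reserve = S″ , extended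
  where
  instance
    N≢0 : NonZero N
    N≢0 = >-nonZero (<-≤-trans (≤-<-trans z≤n 2t<k) k≤N)
  t≤N : t ≤ N
  t≤N = ≤-trans (m≤m*n t 2) (≤-trans (<⇒≤ 2t<k) k≤N)
  open Extension S uS grid lines |S|≡kN reserve 2t<k (select t≤N uS grid |S|≡kN)

lemma3p11 : (h k n : ℕ) → h ≤ k → k ≤ n → 2 ∣ h →
    (S : List Point) → NoInLine k n S → length S ≡ k * n → HasReserve h k n S →
    Σ (List Point) λ S″ → NoInLine k (n + h / 2) S″ × length S″ ≡ k * (n + h / 2)
lemma3p11 .(0 * 2) k n _ _ (divides zero refl) S noLine |S|≡kn _ =
  S , subst (λ m → NoInLine k m S × length S ≡ k * m) (sym (+-identityʳ n)) (noLine , |S|≡kn)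
lemma3p11 .(t * 2) k n 2t≤k k≤n (divides t@(suc _) refl) S noLine |S|≡kn reserve
  rewrite m*n/n≡m t 2 {{_}} with k ≟ t * 2
... | yes k≡2t = ⊥-elim (fullReserve-impossible (subst (1 <_) (sym k≡2t) (s≤s (s≤s z≤n))) k≤n noLine |S|≡kn
                          (subst (λ h → HasReserve h k n S) (sym k≡2t) reserve))
... | no k≢2t  = reserveExtension t (≤∧≢⇒< 2t≤k (k≢2t ∘ sym)) k≤n noLine |S|≡kn reserve
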